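{- We have $r_0=1$, $\tilde r_0=0$, $r_1=a_1-b_1$, $\tilde r_1=1$, and for every $k\ge0$, $$r_{k+1}=r_k+(a_{k+1}-b_{k+1}-1)q_k+q_{k-1},\qquad \tilde r_{k+1}=\tilde r_k+(a_{k+1}-b_{k+1}-1)p_k+p_{k-1}.$$ Consequently, for every $k\ge0$, $$r_{k+1}=1-q_k+\sum_{j=0}^k(a_{j+1}-b_{j+1})q_j=q_{k+1}-t_{k+1},\qquad \tilde r_{k+1}=1-p_k+\sum_{j=0}^k(a_{j+1}-b_{j+1})p_j=p_{k+1}-\tilde t_{k+1}.$$ Moreover, $0\le t_k<q_k$, $0\le\tilde t_k\le p_k$, $1\le r_k\le q_k$ and $0\le\tilde r_k\le p_k$ for every $k\ge0$.
   Context: Let $\theta\in(0,1)$ be irrational with $\theta=[0;a_1,a_2,\ldots]$ and convergents $p_k/q_k$ ($p_{ -1}=1,q_{ -1}=0,p_0=0,q_0=1$, $p_{k+1}=a_{k+1}p_k+p_{k-1}$, $q_{k+1}=a_{k+1}q_k+q_{k-1}$). Let $\rho\in[0,1)$ and let $(b_k)_{k\ge1}$ be the digits of $\rho-\theta$ in the Ostrowski numeration system with base $\theta$: $\rho-\theta=\sum_{k\ge0}b_{k+1}(q_k\theta-p_k)$, where the integers $b_k$ satisfy $0\le b_1\le a_1-1$, $0\le b_k\le a_k$ for $k\ge2$, and $b_{k+1}=a_{k+1}\Rightarrow b_k=0$ for $k\ge1$. For $k\ge0$ (empty sums being $0$): $t_k=\sum_{j=1}^k b_jq_{j-1}$, $\tilde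 t_k=\sum_{j=1}^k b_jp_{j-1}$, $r_k=q_k-t_k$, $\tilde r_k=p_k-\tilde t_k$. -}

module Defs where

open import Data.Nat using (ℕ; zero; suc; _+_; _*_; _≤_; _<_)
open import Data.Integer using (ℤ; +_) renaming (_+_ to _+ℤ_; _-_ to _-ℤ_)
open import Data.Product using (_×_; _,_; proj₁; proj₂)
open import Relation.Binary.PropositionalEquality using (_≡_)

-- Partial quotients a k (k ≥ 1; a 0 is ignored), digits b k (k ≥ 1; b 0 ignored).

-- Pair (q_{k-1}, q_k), with q_{-1} = 0, q_0 = 1, q_{k+1} = a_{k+1} q_k + q_{k-1}.
qPair : (ℕ → ℕ) → ℕ → ℕ × ℕ
qPair a zero = 0 , 1
qPair a (suc k) with qPair a k
... | x , y = y , (a (suc k) * y + x)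

pPair : (ℕ → ℕ) → ℕ → ℕ × ℕ
pPair a zero = 1 , 0
pPair a (suc k) with pPair a k
... | x , y = y , (a (suc k) * y + x)

q : (ℕ → ℕ) → ℕ → ℕ
q a k = proj₂ (qPair a k)

qPrev : (ℕ → ℕ) → ℕ → ℕ
qPrev a k = proj₁ (qPair a k)

p : (ℕ → ℕ) → ℕ → ℕ
p a k = proj₂ (pPair a k)

pPrev : (ℕ → ℕ) → ℕ → ℕ
pPrev a k = proj₁ (pPair a k)

t : (ℕ → ℕ) → (ℕ → ℕ) → ℕ → ℕ
t a b zero = 0
t a b (suc k) = t a b k + b (suc k) * q a k

t~ : (ℕ → ℕ) → (ℕ → ℕ) → ℕ → ℕ
t~ a b zero = 0
t~ a b (suc k) = t~ a b k + b (suc k) * p a k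

r : (ℕ → ℕ) → (ℕ → ℕ) → ℕ → ℤ
r a b k = + q a k -ℤ + t a b k

r~ : (ℕ → ℕ) → (ℕ → ℕ) → ℕ → ℤ
r~ a b k = + p a k -ℤ + t~ a b k

sumBelow : (ℕ → ℤ) → ℕ → ℤ
sumBelow f zero = + 0
sumBelow f (suc n) = sumBelow f n +ℤ f n

-- Ostrowski admissibility of the digit sequence b w.r.t. the partial quotients a
-- (θ ∈ (0,1) irrational: all a_k ≥ 1 for k ≥ 1).
record Admissible (a b : ℕ → ℕ) : Set where
  field
    a-pos    : ∀ k → 1 ≤ a (suc k)
    b₁<a₁    : b 1 < a 1
    bₖ≤aₖ    : ∀ k → b (suc (suc k)) ≤ a (suc (suc k))
    markov   : ∀ k → b (suc (suc k)) ≡ a (suc (suc k)) → b (suc k) ≡ 0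

{-# OPTIONS --safe #-}
module Submission where

open import Defs
open import Data.Nat using (ℕ; suc; zero) renaming (_≤_ to _≤ℕ_; _<_ to _<ℕ_)
open import Data.Integer using (ℤ; +_; _+_; _-_; _*_; _≤_; +≤+)
open import Data.Product using (_×_; _,_; proj₁)
open import Data.Sum using (inj₁; inj₂)
open import Relation.Binary.PropositionalEquality
  using (_≡_; refl; sym; trans; cong; cong₂; subst; subst₂; module ≡-Reasoning)
import Data.Nat as ℕ
import Data.Nat.Properties as ℕ
import Data.Integer.Properties as ℤ
open import Data.Integer.Tactic.RingSolver using (solve-∀)

-- Both (q, t) and (p, t̃) are instances of one pattern: a continuant u of the partial
-- quotients a, and the digit sum s of b against it. The integer ρ = u − s then satisfies
-- the stated recurrence and telescoping formula, and admissibility keeps s below u.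

ostrowski-step-≤ : ∀ {T₀ T₁ Q₀ Q₁ A B} → T₀ ≤ℕ Q₀ → T₁ ≤ℕ Q₁ → B ≤ℕ A →
                   (B ≡ A → T₁ ≡ T₀) → T₁ ℕ.+ B ℕ.* Q₁ ≤ℕ A ℕ.* Q₁ ℕ.+ Q₀
ostrowski-step-≤ {T₀} {T₁} {Q₀} {Q₁} {A} {B} T₀≤Q₀ T₁≤Q₁ B≤A carry
  with ℕ.m≤n⇒m<n∨m≡n B≤A
... | inj₁ B<A = begin
  T₁ ℕ.+ B ℕ.* Q₁   ≤⟨ ℕ.+-monoˡ-≤ (B ℕ.* Q₁) T₁≤Q₁ ⟩
  suc B ℕ.* Q₁      ≤⟨ ℕ.*-monoˡ-≤ Q₁ B<A ⟩
  A ℕ.* Q₁          ≤⟨ ℕ.m≤m+n (A ℕ.* Q₁) Q₀ ⟩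
  A ℕ.* Q₁ ℕ.+ Q₀   ∎
  where open ℕ.≤-Reasoning
... | inj₂ refl = begin
  T₁ ℕ.+ B ℕ.* Q₁   ≡⟨ cong (ℕ._+ B ℕ.* Q₁) (carry refl) ⟩
  T₀ ℕ.+ B ℕ.* Q₁   ≤⟨ ℕ.+-monoˡ-≤ (B ℕ.* Q₁) T₀≤Q₀ ⟩
  Q₀ ℕ.+ B ℕ.* Q₁   ≡⟨ ℕ.+-comm Q₀ (B ℕ.* Q₁) ⟩
  B ℕ.* Q₁ ℕ.+ Q₀   ∎
  where open ℕ.≤-Reasoning

+m≤+o-+n : ∀ m {n o} → m ℕ.+ n ≤ℕ o → + m ≤ + o - + n
+m≤+o-+n m {n} {o} m+n≤o
  rewrite ℤ.m-n≡m⊖n o n | ℤ.⊖-≥ (ℕ.m+n≤o⇒n≤o m m+n≤o) = +≤+ (ℕ.m+n≤o⇒m≤o∸n m m+n≤o)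

+m-+n≤+m : ∀ m n → + m - + n ≤ + m
+m-+n≤+m m n rewrite ℤ.m-n≡m⊖n m n = ℤ.m⊖n≤m m n

module DigitSum (a b u u₋ s : ℕ → ℕ)
  (u-suc : ∀ k → u (suc k) ≡ a (suc k) ℕ.* u k ℕ.+ u₋ k)
  (u₋-suc : ∀ k → u₋ (suc k) ≡ u k)
  (s-suc : ∀ k → s (suc k) ≡ s k ℕ.+ b (suc k) ℕ.* u k)
  where

  ρ : ℕ → ℤ
  ρ k = + u k - + s k

  digitTerm : ℕ → ℤ
  digitTerm j = (+ a (suc j) - + b (suc j)) * + u j

  ρ-suc : ∀ k → ρ (suc k) ≡ ρ k + (+ a (suc k) - + b (suc k) - + 1) * + u k + + u₋ k
  ρ-suc k = begin
    + u (suc k) - + s (suc k)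
      ≡⟨ cong₂ (λ x y → + x - + y) (u-suc k) (s-suc k) ⟩
    + (A ℕ.* U ℕ.+ U₋) - + (S ℕ.+ B ℕ.* U)
      ≡⟨ cong₂ _-_ (+-linear A U U₋) (trans (ℤ.pos-+ S (B ℕ.* U)) (cong (_+_ (+ S)) (ℤ.pos-* B U))) ⟩
    (+ A * + U + + U₋) - (+ S + + B * + U)
      ≡⟨ regroup (+ A) (+ B) (+ U) (+ U₋) (+ S) ⟩
    (+ U - + S) + (+ A - + B - + 1) * + U + + U₋
      ∎
    where
    open ≡-Reasoning
    A = a (suc k); B = b (suc k); U = u k; U₋ = u₋ k; S = s k
    +-linear : ∀ x y z → + (x ℕ.* y ℕ.+ z) ≡ + x * + y + + z
    +-linear x y z = trans (ℤ.pos-+ (x ℕ.* y) z) (cong (_+ + z) (ℤ.pos-* x y))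
    regroup : ∀ A B U U₋ S → (A * U + U₋) - (S + B * U) ≡ (U - S) + (A - B - + 1) * U + U₋
    regroup = solve-∀

  ρ-telescope : ∀ k → ρ (suc k) ≡ ρ 0 + + u₋ 0 - + u k + sumBelow digitTerm (suc k)
  ρ-telescope zero = trans (ρ-suc 0) (base (ρ 0) (+ a 1) (+ b 1) (+ u 0) (+ u₋ 0))
    where
    base : ∀ R A B U U₋ → R + (A - B - + 1) * U + U₋ ≡ R + U₋ - U + (+ 0 + (A - B) * U)
    base = solve-∀
  ρ-telescope (suc k) = begin
    ρ (suc (suc k))
      ≡⟨ ρ-suc (suc k) ⟩
    ρ (suc k) + (A - B - + 1) * U + + u₋ (suc k)
      ≡⟨ cong₂ (λ x y → x + (A - B - + 1) * U + + y) (ρ-telescope k) (u₋-suc k) ⟩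
    ρ 0 + + u₋ 0 - + u k + Σ + (A - B - + 1) * U + + u k
      ≡⟨ step (ρ 0 + + u₋ 0) Σ A B U (+ u k) ⟩
    ρ 0 + + u₋ 0 - U + (Σ + (A - B) * U)
      ∎
    where
    open ≡-Reasoning
    A = + a (suc (suc k)); B = + b (suc (suc k)); U = + u (suc k)
    Σ = sumBelow digitTerm (suc k)
    step : ∀ C Σ A B U U′ → C - U′ + Σ + (A - B - + 1) * U + U′ ≡ C - U + (Σ + (A - B) * U)
    step = solve-∀

  -- With c = 1 this is the strict bound s k < u k, with c = 0 the weak one.
  digitSum-bounded : Admissible a b → (c : ℕ) →
    c ℕ.+ s 0 ≤ℕ u 0 → c ℕ.+ s 1 ≤ℕ u 1 → ∀ k → c ℕ.+ s k ≤ℕ u k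
  digitSum-bounded adm c bound₀ bound₁ k = proj₁ (consecutive k)
    where
    open Admissible adm
    carry : ∀ k → b (suc (suc k)) ≡ a (suc (suc k)) → c ℕ.+ s (suc k) ≡ c ℕ.+ s k
    carry k bₖ₊₂≡aₖ₊₂ = cong (c ℕ.+_) (begin
      s (suc k)                    ≡⟨ s-suc k ⟩
      s k ℕ.+ b (suc k) ℕ.* u k    ≡⟨ cong (λ x → s k ℕ.+ x ℕ.* u k) (markov k bₖ₊₂≡aₖ₊₂) ⟩
      s k ℕ.+ 0                    ≡⟨ ℕ.+-identityʳ (s k) ⟩
      s k                          ∎)
      where open ≡-Reasoning
    consecutive : ∀ k → (c ℕ.+ s k ≤ℕ u k) × (c ℕ.+ s (suc k) ≤ℕ u (suc k))
    consecutive zero = bound₀ , bound₁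
    consecutive (suc k) with consecutive k
    ... | boundₖ , boundₖ₊₁ = boundₖ₊₁ , unfold (ostrowski-step-≤ boundₖ boundₖ₊₁ (bₖ≤aₖ k) (carry k))
      where
      unfold : c ℕ.+ s (suc k) ℕ.+ b (suc (suc k)) ℕ.* u (suc k)
                 ≤ℕ a (suc (suc k)) ℕ.* u (suc k) ℕ.+ u k →
               c ℕ.+ s (suc (suc k)) ≤ℕ u (suc (suc k))
      unfold le rewrite s-suc (suc k) | u-suc (suc k) | u₋-suc k
                      | ℕ.+-assoc c (s (suc k)) (b (suc (suc k)) ℕ.* u (suc k)) = le

  ρ-bounds : ∀ c k → c ℕ.+ s k ≤ℕ u k → (+ c ≤ ρ k) × (ρ k ≤ + u k)
  ρ-bounds c k bound = +m≤+o-+n c bound , +m-+n≤+m (u k) (s k)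

lemma2p1 : (a b : ℕ → ℕ) → Admissible a b →
    (r a b 0 ≡ + 1) × (r~ a b 0 ≡ + 0)
    × (r a b 1 ≡ + a 1 - + b 1) × (r~ a b 1 ≡ + 1)
    × (∀ k → r a b (suc k) ≡ r a b k + (+ a (suc k) - + b (suc k) - + 1) * + q a k + + qPrev a k)
    × (∀ k → r~ a b (suc k) ≡ r~ a b k + (+ a (suc k) - + b (suc k) - + 1) * + p a k + + pPrev a k)
    × (∀ k → (r a b (suc k) ≡ + 1 - + q a k + sumBelow (λ j → (+ a (suc j) - + b (suc j)) * + q a j) (suc k))
           × (r a b (suc k) ≡ + q a (suc k) - + t a b (suc k)))
    × (∀ k → (r~ a b (suc k) ≡ + 1 - + p a k + sumBelow (λ j → (+ a (suc j) - + b (suc j)) * + p a j) (suc k))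
           × (r~ a b (suc k) ≡ + p a (suc k) - + t~ a b (suc k)))
    × (∀ k → (t a b k <ℕ q a k) × (t~ a b k ≤ℕ p a k)
           × (+ 1 ≤ r a b k) × (r a b k ≤ + q a k)
           × (+ 0 ≤ r~ a b k) × (r~ a b k ≤ + p a k))
lemma2p1 a b adm =
  refl , refl , r₁ , r~₁ , Q.ρ-suc , P.ρ-suc ,
  -- in both instances ρ 0 + u₋ 0 computes to + 1
  (λ k → Q.ρ-telescope k , refl) , (λ k → P.ρ-telescope k , refl) ,
  λ k → let r-lo , r-hi = Q.ρ-bounds 1 k (t<q k) ; r~-lo , r~-hi = P.ρ-bounds 0 k (t~≤p k)
        in t<q k , t~≤p k , r-lo , r-hi , r~-lo , r~-hi
  where
  open Admissible adm
  module Q = DigitSum a b (q a) (qPrev a) (t a b) (λ _ → refl) (λ _ → refl) (λ _ → refl)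
  module P = DigitSum a b (p a) (pPrev a) (t~ a b) (λ _ → refl) (λ _ → refl) (λ _ → refl)
  r₁ : r a b 1 ≡ + a 1 - + b 1
  r₁ = cong₂ (λ x y → + x - + y) (trans (ℕ.+-identityʳ _) (ℕ.*-identityʳ (a 1))) (ℕ.*-identityʳ (b 1))
  r~₁ : r~ a b 1 ≡ + 1
  r~₁ = cong₂ (λ x y → + (x ℕ.+ 1) - + y) (ℕ.*-zeroʳ (a 1)) (ℕ.*-zeroʳ (b 1))
  t<q : ∀ k → t a b k <ℕ q a k
  t<q = Q.digitSum-bounded adm 1 (ℕ.s≤s ℕ.z≤n)
         (subst₂ _<ℕ_ (sym (ℕ.*-identityʳ (b 1))) (sym (trans (ℕ.+-identityʳ _) (ℕ.*-identityʳ (a 1)))) b₁<a₁)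
  t~≤p : ∀ k → t~ a b k ≤ℕ p a k
  t~≤p = P.digitSum-bounded adm 0 ℕ.z≤n (subst (_≤ℕ p a 1) (sym (ℕ.*-zeroʳ (b 1))) ℕ.z≤n)
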